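{- For integers $2 \le r < k < 2r-1$, $\beta_2(k,r) \le 4r-k-2$.
   Context: A $k$-partite graph comes with a fixed partition of its vertex set into $k$ parts (parts may be empty). For $k \ge r \ge 2$ and $1 \le i \le k-r+1$, $\beta_i(k,r)$ is the minimum number of vertices of a $K_r$-free $k$-partite graph such that, for every choice of $k-i$ of its parts, the subgraph induced by those parts contains a $K_{r-1}$. -}

module Defs where

open import Data.Nat using (ℕ; _∸_; _≤_)
open import Data.Fin using (Fin)
open import Data.Fin.Subset using (Subset; _∈_; ∣_∣)
open import Data.Product using (Σ; ∃; _×_)
open import Relation.Binary.PropositionalEquality using (_≡_; _≢_)
open import Relation.Nullary using (¬_)
open import Function.Definitions using (Injective)

-- A k-partite graph on the vertex set Fin n: a (simple, undirected) graph
-- together with a fixed assignment of each vertex to one of k parts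
-- (parts may be empty), such that each part is an independent set.
record KPartiteGraph (k n : ℕ) : Set₁ where
  field
    part    : Fin n → Fin k
    Adj     : Fin n → Fin n → Set
    sym     : ∀ {x y} → Adj x y → Adj y x
    irrefl  : ∀ {x} → ¬ Adj x x
    partite : ∀ {x y} → Adj x y → part x ≢ part y

open KPartiteGraph public

IsClique : ∀ {k n} → KPartiteGraph k n → (m : ℕ) → (Fin m → Fin n) → Set
IsClique G m f = Injective _≡_ _≡_ f × (∀ i j → i ≢ j → Adj G (f i) (f j))

KFree : ∀ {k n} → KPartiteGraph k n → ℕ → Set
KFree G r = ¬ (Σ (Fin r → Fin _) λ f → IsClique G r f)

ContainsCliqueIn : ∀ {k n} → KPartiteGraph k n → Subset k → ℕ → Set
ContainsCliqueIn G S m =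
  Σ (Fin m → Fin _) λ f → IsClique G m f × (∀ i → part G (f i) ∈ S)

-- G witnesses the defining property of β_i(k,r): G is K_r-free and for
-- every choice of k-i of its parts, the induced subgraph contains K_{r-1}.
Admissible : ∀ {k n} → (i r : ℕ) → KPartiteGraph k n → Set
Admissible {k} i r G =
  KFree G r × (∀ (S : Subset k) → ∣ S ∣ ≡ k ∸ i → ContainsCliqueIn G S (r ∸ 1))

-- "β_i(k,r) ≤ b": β_i(k,r) is a minimum over admissible graphs, so this
-- holds iff some admissible k-partite graph has at most b vertices.
βLe : (i k r b : ℕ) → Set₁
βLe i k r b = Σ ℕ λ n → n ≤ b × Σ (KPartiteGraph k n) λ G → Admissible i r G

module Submission where

-- Write k = c + 2a + 1 and r = c + a + 1 with a ≥ 1.  The witness is built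
-- in two stages.
--
-- The complement of the odd cycle C_{2a+1}, every vertex in its own
-- part, has 2a + 1 parts and vertices.  It is K_{a+1}-free (halving the
-- labels is a pigeonhole map that merges only cycle-adjacent vertices) and,
-- for any two parts, contains a K_a avoiding both (a "staircase" independent
-- set of the cycle, chosen by the parities of the two avoided labels).
--
-- From a k-partite G with two distinct parts X, Y, add a new
-- part and three pairwise non-adjacent vertices lying in the new part, in X
-- and in Y, each joined to every old vertex outside its own part.  A clique
-- uses at most one new vertex, so K_r-freeness goes up to K_{r+1}; and a
-- K_m avoiding any two parts goes up to a K_{m+1} avoiding any two parts.
--
-- Iterating the extension c times on the base gives 3c + 2a + 1 = 4r − k − 2
-- vertices.  Finally, a K_r-free graph in which every two parts can be
-- avoided by a K_{r-1} is admissible for β₂, since k − 2 parts omit at most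
-- two parts.

open import Defs
open import Data.Nat using (ℕ; _≤_; _<_; _*_; _∸_)
open import Data.Nat using (zero; suc; _+_; z≤n; s≤s; s≤s⁻¹; pred; ⌊_/2⌋; _≤?_; _≟_)
open import Data.Nat.Properties
  using ( ≤-refl; ≤-trans; ≤-reflexive; ≤-antisym; <-≤-trans; <⇒≢; <⇒≱; ≰⇒>; ≤∧≢⇒<; <-cmp
        ; n<1+n; n≤1+n; 1+n≰n; m≤m+n; m≤n+m; m∸n≤m; m≤n+m∸n; m+n∸n≡m; +-suc; +-identityʳ; +-mono-≤
        ; +-monoʳ-<; +-cancelˡ-≤; suc-injective; ⌊n/2⌋-mono; n≡⌈n+n/2⌉; even≢odd
        ; m≤n⇒∃[o]m+o≡n; module ≤-Reasoning )
open import Data.Nat.Tactic.RingSolver using (solve-∀)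
open import Data.Fin using (Fin; zero; suc; toℕ; fromℕ<; _↑ˡ_; _↑ʳ_; splitAt; punchIn)
open import Data.Fin.Properties
  using (toℕ-fromℕ<; toℕ-injective; toℕ<n; pigeonhole; any?; punchIn-injective; punchInᵢ≢i
        ; splitAt-↑ˡ; ↑ʳ-injective)
  renaming (_≟_ to _≟ᶠ_; suc-injective to Fin-suc-injective; <⇒≢ to <⇒≢ᶠ)
open import Data.Fin.Subset using (Subset; _∈_; ∣_∣; inside; outside)
open import Data.Fin.Subset.Properties using (∣p∣≤n; ∣p∣≡n⇒p≡⊤; ∈⊤)
open import Data.Vec using ([]; _∷_; here; there)
open import Data.Product using (Σ; ∃; ∃₂; _×_; _,_; proj₁; proj₂)
open import Data.Sum using (_⊎_; inj₁; inj₂)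
import Data.Sum as Sum
open import Data.Empty using (⊥; ⊥-elim)
open import Function using (_∘_; id)
open import Relation.Nullary using (¬_; Dec; yes; no)
open import Relation.Nullary.Decidable using (¬?; decidable-stable)
open import Relation.Binary using (tri<; tri≈; tri>)
open import Relation.Binary.PropositionalEquality
  using (_≡_; _≢_; refl; trans; cong; subst; subst₂; ≢-sym; module ≡-Reasoning)
  renaming (sym to ≡-sym)

Pairwise : ∀ {k n m} → KPartiteGraph k n → (Fin m → Fin n) → Set
Pairwise G f = ∀ i j → i ≢ j → Adj G (f i) (f j)

CliqueFree : ∀ {k n} → KPartiteGraph k n → ℕ → Set
CliqueFree {n = n} G m = (f : Fin m → Fin n) → ¬ Pairwise G f

Avoids : ∀ {k} → Fin k → Fin k → Fin k → Set
Avoids p u w = p ≢ u × p ≢ w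

CliqueAvoiding : ∀ {k n} → KPartiteGraph k n → ℕ → Fin k → Fin k → Set
CliqueAvoiding {n = n} G m u w =
  Σ (Fin m → Fin n) λ f → Pairwise G f × (∀ i → Avoids (part G (f i)) u w)

Robust : ∀ {k n} → KPartiteGraph k n → ℕ → Set
Robust {k} G m = (u w : Fin k) → CliqueAvoiding G m u w

swapAvoiding : ∀ {k n m} {G : KPartiteGraph k n} {u w} →
               CliqueAvoiding G m u w → CliqueAvoiding G m w u
swapAvoiding (f , pw , av) = f , pw , λ i → proj₂ (av i) , proj₁ (av i)

-- Irreflexivity makes a pairwise adjacent family injective.
pairwise⇒clique : ∀ {k n m} (G : KPartiteGraph k n) {f : Fin m → Fin n} →
                  Pairwise G f → IsClique G m f
pairwise⇒clique G {f} pw = injective , pw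
  where
  injective : ∀ {i j} → f i ≡ f j → i ≡ j
  injective {i} {j} e with i ≟ᶠ j
  ... | yes i≡j = i≡j
  ... | no i≢j = ⊥-elim (irrefl G (subst (Adj G (f i)) (≡-sym e) (pw i j i≢j)))

full : ∀ {K} (S : Subset K) → K ≤ ∣ S ∣ → ∀ x → x ∈ S
full S h x = subst (x ∈_) (≡-sym (∣p∣≡n⇒p≡⊤ (≤-antisym (∣p∣≤n S) h))) ∈⊤

omitsAtMostOne : ∀ {K} (S : Subset (suc K)) → suc K ≤ suc ∣ S ∣ →
                 ∃ λ w → ∀ x → x ≡ w ⊎ x ∈ S
omitsAtMostOne (inside ∷ []) _ = zero , λ { zero → inj₂ here }
omitsAtMostOne (inside ∷ (b ∷ S)) h with omitsAtMostOne (b ∷ S) (s≤s⁻¹ h)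
... | w , cover = suc w , λ { zero → inj₂ here
                            ; (suc x) → Sum.map (cong suc) there (cover x) }
omitsAtMostOne (outside ∷ S) h =
  zero , λ { zero → inj₁ refl ; (suc x) → inj₂ (there (full S (s≤s⁻¹ h) x)) }

omitsAtMostTwo : ∀ {K} (S : Subset (suc K)) → suc K ≤ 2 + ∣ S ∣ →
                 ∃₂ λ u w → ∀ x → x ≡ u ⊎ x ≡ w ⊎ x ∈ S
omitsAtMostTwo (inside ∷ []) _ = zero , zero , λ { zero → inj₂ (inj₂ here) }
omitsAtMostTwo (inside ∷ (b ∷ S)) h with omitsAtMostTwo (b ∷ S) (s≤s⁻¹ h)
... | u , w , cover =
  suc u , suc w , λ { zero → inj₂ (inj₂ here)
                    ; (suc x) → Sum.map (cong suc) (Sum.map (cong suc) there) (cover x) }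
omitsAtMostTwo (outside ∷ []) _ = zero , zero , λ { zero → inj₁ refl }
omitsAtMostTwo (outside ∷ (b ∷ S)) h with omitsAtMostOne (b ∷ S) (s≤s⁻¹ h)
... | w , cover = zero , suc w , λ { zero → inj₁ refl
                                   ; (suc x) → inj₂ (Sum.map (cong suc) there (cover x)) }

-- The β₂ conditions follow from K_{m+1}-freeness and robustness for K_m:
-- a choice of k − 2 parts omits at most two parts u, w (G needs some part).
admissible : ∀ {k n m} (G : KPartiteGraph k n) → Fin k →
             CliqueFree G (suc m) → Robust G m → Admissible 2 (suc m) G
admissible {suc k} G _ free robust = (λ (f , clique) → free f (proj₂ clique)) , cliqueIn
  where
  cliqueIn : ∀ S → ∣ S ∣ ≡ suc k ∸ 2 → ContainsCliqueIn G S _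
  cliqueIn S |S| with omitsAtMostTwo S (subst (λ s → suc k ≤ 2 + s) (≡-sym |S|) (m≤n+m∸n (suc k) 2))
  ... | u , w , cover with robust u w
  ...   | f , pw , av = f , pairwise⇒clique G pw , inS
    where
    inS : ∀ i → part G (f i) ∈ S
    inS i with cover (part G (f i))
    ... | inj₁ p≡u = ⊥-elim (proj₁ (av i) p≡u)
    ... | inj₂ (inj₁ p≡w) = ⊥-elim (proj₂ (av i) p≡w)
    ... | inj₂ (inj₂ p∈S) = p∈S

-- The extension step

module Extension {k n} (G : KPartiteGraph k n) (X Y : Fin k) where

  newPart : Fin 3 → Fin (suc k)
  newPart zero = zero
  newPart (suc zero) = suc X
  newPart (suc (suc zero)) = suc Y

  Vertex : Set
  Vertex = Fin 3 ⊎ Fin n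

  partᵛ : Vertex → Fin (suc k)
  partᵛ (inj₁ t) = newPart t
  partᵛ (inj₂ v) = suc (part G v)

  Adjᵛ : Vertex → Vertex → Set
  Adjᵛ (inj₁ _) (inj₁ _) = ⊥
  Adjᵛ (inj₁ t) (inj₂ v) = newPart t ≢ suc (part G v)
  Adjᵛ (inj₂ v) (inj₁ t) = suc (part G v) ≢ newPart t
  Adjᵛ (inj₂ u) (inj₂ v) = Adj G u v

  Adjᵛ-sym : ∀ x y → Adjᵛ x y → Adjᵛ y x
  Adjᵛ-sym (inj₁ _) (inj₂ _) ne = ≢-sym ne
  Adjᵛ-sym (inj₂ _) (inj₁ _) ne = ≢-sym ne
  Adjᵛ-sym (inj₂ _) (inj₂ _) uv = sym G uv

  Adjᵛ-irrefl : ∀ x → ¬ Adjᵛ x x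
  Adjᵛ-irrefl (inj₂ _) vv = irrefl G vv

  Adjᵛ-partite : ∀ x y → Adjᵛ x y → partᵛ x ≢ partᵛ y
  Adjᵛ-partite (inj₁ _) (inj₂ _) ne = ne
  Adjᵛ-partite (inj₂ _) (inj₁ _) ne = ne
  Adjᵛ-partite (inj₂ _) (inj₂ _) uv = partite G uv ∘ Fin-suc-injective

  -- Vertex 3 + v of the extension is the old vertex v.
  extended : KPartiteGraph (suc k) (3 + n)
  extended = record
    { part    = partᵛ ∘ splitAt 3
    ; Adj     = λ x y → Adjᵛ (splitAt 3 x) (splitAt 3 y)
    ; sym     = λ {x} {y} → Adjᵛ-sym (splitAt 3 x) (splitAt 3 y)
    ; irrefl  = λ {x} → Adjᵛ-irrefl (splitAt 3 x)
    ; partite = λ {x} {y} → Adjᵛ-partite (splitAt 3 x) (splitAt 3 y)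
    }

  data Old : Vertex → Set where
    old : (v : Fin n) → Old (inj₂ v)

  oldVertex : ∀ {x} → Old x → Fin n
  oldVertex (old v) = v

  old? : ∀ x → Dec (Old x)
  old? (inj₁ _) = no λ ()
  old? (inj₂ v) = yes (old v)

  oldAdj : ∀ {x y} (p : Old x) (q : Old y) → Adjᵛ x y → Adj G (oldVertex p) (oldVertex q)
  oldAdj (old _) (old _) uv = uv

  neighbourOfNew : ∀ x y → ¬ Old x → Adjᵛ x y → Old y
  neighbourOfNew (inj₁ _) (inj₂ v) _ _ = old v
  neighbourOfNew (inj₂ v) _ notOld _ = ⊥-elim (notOld (old v))

  allButOneOld : ∀ {m} (f : Fin (suc m) → Fin (3 + n)) → Pairwise extended f →
                 Σ (Fin (suc m)) λ i → ∀ j → Old (splitAt 3 (f (punchIn i j)))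
  allButOneOld f pw with any? (λ i → ¬? (old? (splitAt 3 (f i))))
  ... | yes (i , notOld) =
    i , λ j → neighbourOfNew _ _ notOld (pw i (punchIn i j) (≢-sym (punchInᵢ≢i i j)))
  ... | no noneNew = zero , λ j → decidable-stable (old? _) (λ notOld → noneNew (suc j , notOld))

  extended-cliqueFree : ∀ {r} → CliqueFree G r → CliqueFree extended (suc r)
  extended-cliqueFree free f pw with allButOneOld f pw
  ... | i , isOld = free (λ j → oldVertex (isOld j)) λ j j′ j≢j′ →
    oldAdj (isOld j) (isOld j′) (pw _ _ (j≢j′ ∘ punchIn-injective i j j′))

  cone : ∀ {m} → Fin 3 → (Fin m → Fin n) → Fin (suc m) → Fin (3 + n)
  cone t f zero = t ↑ˡ n
  cone t f (suc i) = 3 ↑ʳ f i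

  apex-part : ∀ {m} t (f : Fin m → Fin n) → part extended (cone t f zero) ≡ newPart t
  apex-part t f = cong partᵛ (splitAt-↑ˡ 3 t n)

  cone-pairwise : ∀ {m} t (f : Fin m → Fin n) → Pairwise G f →
                  (∀ i → suc (part G (f i)) ≢ newPart t) → Pairwise extended (cone t f)
  cone-pairwise t f pw sees zero zero ne = ⊥-elim (ne refl)
  cone-pairwise t f pw sees zero (suc j) _ =
    subst (λ x → Adjᵛ x (inj₂ (f j))) (≡-sym (splitAt-↑ˡ 3 t n)) (≢-sym (sees j))
  cone-pairwise t f pw sees (suc i) zero _ =
    subst (Adjᵛ (inj₂ (f i))) (≡-sym (splitAt-↑ˡ 3 t n)) (sees i)
  cone-pairwise t f pw sees (suc i) (suc j) ne = pw i j (ne ∘ cong suc)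

  coneAvoiding : ∀ {m u w} t → Avoids (newPart t) u w → (f : Fin m → Fin n) → Pairwise G f →
                 (∀ i → suc (part G (f i)) ≢ newPart t × Avoids (suc (part G (f i))) u w) →
                 CliqueAvoiding extended (suc m) u w
  coneAvoiding {u = u} {w} t apexAvoids f pw oldAvoid =
    cone t f , cone-pairwise t f pw (proj₁ ∘ oldAvoid) , avoids
    where
    avoids : ∀ i → Avoids (part extended (cone t f i)) u w
    avoids zero = subst (λ p → Avoids p u w) (≡-sym (apex-part t f)) apexAvoids
    avoids (suc i) = proj₂ (oldAvoid i)

  lift : ∀ {p q : Fin k} → p ≢ q → suc p ≢ suc q
  lift p≢q = p≢q ∘ Fin-suc-injective

  -- Two old parts are avoided by the apex 0; the new part 0 together with a
  -- part w is avoided by the apex in X, or in Y when w is X.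
  extended-robust : X ≢ Y → ∀ {m} → Robust G m → Robust extended (suc m)
  extended-robust X≢Y {m} robust = robust′
    where
    newAndOld : ∀ w → CliqueAvoiding extended (suc m) zero w
    newAndOld zero with robust X Y
    ... | f , pw , av = coneAvoiding (suc zero) ((λ ()) , (λ ())) f pw
                          λ i → lift (proj₁ (av i)) , (λ ()) , (λ ())
    newAndOld (suc w) with w ≟ᶠ X
    ... | yes refl with robust Y X
    ...   | f , pw , av = coneAvoiding (suc (suc zero)) ((λ ()) , lift (≢-sym X≢Y)) f pw
                            λ i → lift (proj₁ (av i)) , (λ ()) , lift (proj₂ (av i))
    newAndOld (suc w) | no w≢X with robust X w
    ...   | f , pw , av = coneAvoiding (suc zero) ((λ ()) , lift (≢-sym w≢X)) f pw
                            λ i → lift (proj₁ (av i)) , (λ ()) , lift (proj₂ (av i))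

    robust′ : Robust extended (suc m)
    robust′ zero w = newAndOld w
    robust′ (suc u) zero = swapAvoiding {G = extended} (newAndOld (suc u))
    robust′ (suc u) (suc w) with robust u w
    ... | f , pw , av = coneAvoiding zero ((λ ()) , (λ ())) f pw
                          λ i → (λ ()) , lift (proj₁ (av i)) , lift (proj₂ (av i))

module Tower {k n} (G : KPartiteGraph k n) (X Y : Fin k) where

  tower : ∀ c → KPartiteGraph (c + k) (c * 3 + n)
  tower zero = G
  tower (suc c) = Extension.extended (tower c) (c ↑ʳ X) (c ↑ʳ Y)

  tower-cliqueFree : ∀ {m} c → CliqueFree G (suc m) → CliqueFree (tower c) (suc (c + m))
  tower-cliqueFree zero free = free
  tower-cliqueFree (suc c) free =
    Extension.extended-cliqueFree (tower c) _ _ (tower-cliqueFree c free)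

  tower-robust : X ≢ Y → ∀ {m} c → Robust G m → Robust (tower c) (c + m)
  tower-robust X≢Y zero robust = robust
  tower-robust X≢Y (suc c) robust =
    Extension.extended-robust (tower c) _ _ (X≢Y ∘ ↑ʳ-injective c X Y) (tower-robust X≢Y c robust)

Apart : ℕ → ℕ → Set
Apart x y = suc x < y ⊎ suc y < x

apart-sym : ∀ {x y} → Apart x y → Apart y x
apart-sym = Sum.swap

apart⇒≢ : ∀ {x y} → Apart x y → x ≢ y
apart⇒≢ (inj₁ x+1<x) refl = 1+n≰n (≤-trans (n≤1+n _) x+1<x)
apart⇒≢ (inj₂ x+1<x) refl = 1+n≰n (≤-trans (n≤1+n _) x+1<x)

apart-+ : ∀ d {x y} → suc x < y → suc (d + x) < d + y
apart-+ d {x} {y} h = subst (_< d + y) (+-suc d x) (+-monoʳ-< d h)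

apart-pred : ∀ {x y} → x ≢ 0 → y ≢ 0 → Apart x y → Apart (pred x) (pred y)
apart-pred {zero} x≢0 _ = ⊥-elim (x≢0 refl)
apart-pred {suc _} {zero} _ y≢0 = ⊥-elim (y≢0 refl)
apart-pred {suc _} {suc _} _ _ = Sum.map s≤s⁻¹ s≤s⁻¹

apart⇒halves≢ : ∀ {x y} → Apart x y → ⌊ x /2⌋ ≢ ⌊ y /2⌋
apart⇒halves≢ (inj₁ h) = <⇒≢ (⌊n/2⌋-mono h)
apart⇒halves≢ (inj₂ h) = ≢-sym (<⇒≢ (⌊n/2⌋-mono h))

half< : ∀ {x m} → x < m + m → ⌊ x /2⌋ < m
half< {x} {m} h = subst (suc ⌊ x /2⌋ ≤_) (≡-sym (n≡⌈n+n/2⌉ m)) (⌊n/2⌋-mono (s≤s h))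

noApartFamily : ∀ m (g : Fin (suc m) → ℕ) → (∀ i → g i < m + m) →
                ¬ (∀ i j → i ≢ j → Apart (g i) (g j))
noApartFamily m g bound apart with pigeonhole (n<1+n m) (λ i → fromℕ< (half< (bound i)))
... | i , j , i<j , same = apart⇒halves≢ (apart i j (<⇒≢ᶠ i<j)) sameHalf
  where
  sameHalf : ⌊ g i /2⌋ ≡ ⌊ g j /2⌋
  sameHalf = trans (≡-sym (toℕ-fromℕ< _)) (trans (cong toℕ same) (toℕ-fromℕ< _))

-- Staircases: independent sets of the odd cycle

odd≢even : ∀ m n → suc (m + m) ≢ n + n
odd≢even m n e = even≢odd n m (begin
  2 * n         ≡⟨ ≡-sym (double n) ⟩
  n + n         ≡⟨ ≡-sym e ⟩
  suc (m + m)   ≡⟨ cong suc (double m) ⟩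
  suc (2 * m)   ∎)
  where
  open ≡-Reasoning
  double : ∀ x → x + x ≡ 2 * x
  double x = cong (x +_) (≡-sym (+-identityʳ x))

parity : ∀ u → ∃ λ p → u ≡ p + p ⊎ u ≡ suc (p + p)
parity zero = 0 , inj₁ refl
parity (suc u) with parity u
... | p , inj₁ refl = p , inj₂ refl
... | p , inj₂ refl = suc p , inj₁ (cong suc (≡-sym (+-suc p p)))

-- stair z n = 2n for n < z and 2n + 1 for n ≥ z: even numbers below 2z,
-- then odd numbers; consecutive entries differ by at least 2.
stair : ℕ → ℕ → ℕ
stair zero n = suc (n + n)
stair (suc z) zero = 0
stair (suc z) (suc n) = suc (suc (stair z n))

stair-gap : ∀ z {n n′} → n < n′ → suc (stair z n) < stair z n′
stair-gap zero {n} {n′} n<n′ =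
  s≤s (subst (_≤ n′ + n′) (cong suc (+-suc n n)) (+-mono-≤ n<n′ n<n′))
stair-gap (suc z) {zero} {suc n′} _ = s≤s (s≤s z≤n)
stair-gap (suc z) {suc n} {suc n′} (s≤s n<n′) = s≤s (s≤s (stair-gap z n<n′))

stair≤ : ∀ z n → stair z n ≤ suc (n + n)
stair≤ zero n = ≤-refl
stair≤ (suc z) zero = z≤n
stair≤ (suc z) (suc n) = s≤s (subst (suc (stair z n) ≤_) (cong suc (≡-sym (+-suc n n))) (s≤s (stair≤ z n)))

stair-even : ∀ z n p → stair z n ≡ p + p → p < z
stair-even zero n p e = ⊥-elim (odd≢even n p e)
stair-even (suc z) zero zero _ = s≤s z≤n
stair-even (suc z) (suc n) (suc p) e =
  s≤s (stair-even z n p (suc-injective (trans (suc-injective e) (+-suc p p))))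

stair-odd : ∀ z n q → stair z n ≡ suc (q + q) → z ≤ q
stair-odd zero n q _ = z≤n
stair-odd (suc z) (suc n) (suc q) e =
  s≤s (stair-odd z n q (suc-injective (trans (suc-injective e) (cong suc (+-suc q q)))))

stair+1-even : ∀ z n p → suc (stair z n) ≡ p + p → z < p
stair+1-even z n (suc p) e = s≤s (stair-odd z n p (suc-injective (trans e (+-suc (suc p) p))))

-- An even number 2p and an odd number 2q + 1 are avoided by the staircase
-- with z = p, shifted by one exactly when p ≤ q.
avoidingEvenOdd : ∀ p q → Σ ℕ λ d → Σ ℕ λ z → d ≤ 1 ×
                  (∀ n → d + stair z n ≢ p + p × d + stair z n ≢ suc (q + q))
avoidingEvenOdd p q with p ≤? q
... | yes p≤q = 1 , p , ≤-refl , λ n →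
  (λ e → <⇒≢ (stair+1-even p n p e) refl) ,
  (λ e → <⇒≱ (stair-even p n q (suc-injective e)) p≤q)
... | no p≰q = 0 , p , z≤n , λ n →
  (λ e → <⇒≢ (stair-even p n p e) refl) ,
  (λ e → <⇒≱ (≰⇒> p≰q) (stair-odd p n q e))

-- For any two numbers some staircase d + stair z _ with d ≤ 1 avoids both:
-- two evens are avoided by the odd numbers (z = 0), two odds by the evens
-- below them (z large), and mixed parities as above.
avoidingStair : ∀ u w → Σ ℕ λ d → Σ ℕ λ z → d ≤ 1 × (∀ n → d + stair z n ≢ u × d + stair z n ≢ w)
avoidingStair u w with parity u | parity w
... | p , inj₁ refl | q , inj₁ refl = 0 , 0 , z≤n , λ n → evenAbove n p , evenAbove n q
  where
  evenAbove : ∀ n p → stair 0 n ≢ p + p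
  evenAbove n p e = <⇒≱ (stair-even 0 n p e) z≤n
... | p , inj₂ refl | q , inj₂ refl =
  0 , suc (p + q) , z≤n , λ n → oddBelow n p (s≤s (m≤m+n p q)) , oddBelow n q (s≤s (m≤n+m q p))
  where
  oddBelow : ∀ n x → x < suc (p + q) → stair (suc (p + q)) n ≢ suc (x + x)
  oddBelow n x x<z e = <⇒≱ x<z (stair-odd _ n x e)
... | p , inj₁ refl | q , inj₂ refl = avoidingEvenOdd p q
... | p , inj₂ refl | q , inj₁ refl with avoidingEvenOdd q p
...   | d , z , d≤1 , av = d , z , d≤1 , λ n → proj₂ (av n) , proj₁ (av n)

-- The base graph: the complement of the cycle 0 − 1 − ⋯ − 2a − 0

-- 2n + 2 ≤ 2a for n < a: staircases of length a stay inside 0, …, 2a.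
doubled< : ∀ {n a} → n < a → suc (suc (n + n)) ≤ a + a
doubled< {n} {a} n<a = subst (_≤ a + a) (cong suc (+-suc n n)) (+-mono-≤ n<a n<a)

double≢0 : ∀ {a} → 1 ≤ a → a + a ≢ 0
double≢0 (s≤s _) ()

module OddCycleComplement (a : ℕ) where

  -- {0, 2a} is the one cycle edge between non-consecutive numbers.
  WrapEdge : ℕ → ℕ → Set
  WrapEdge x y = x ≡ 0 × y ≡ a + a

  NonAdjacentInCycle : ℕ → ℕ → Set
  NonAdjacentInCycle x y = Apart x y × ¬ WrapEdge x y × ¬ WrapEdge y x

  nonAdjacent-sym : ∀ {x y} → NonAdjacentInCycle x y → NonAdjacentInCycle y x
  nonAdjacent-sym (xy , ¬wxy , ¬wyx) = apart-sym xy , ¬wyx , ¬wxy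

  graph : KPartiteGraph (suc (a + a)) (suc (a + a))
  graph = record
    { part    = id
    ; Adj     = λ x y → NonAdjacentInCycle (toℕ x) (toℕ y)
    ; sym     = nonAdjacent-sym
    ; irrefl  = λ (xx , _) → apart⇒≢ xx refl
    ; partite = λ (xy , _) x≡y → apart⇒≢ xy (cong toℕ x≡y)
    }

  -- An independent set of C_{2a+1} has at most a vertices: if it misses 2a,
  -- halve the labels; if it misses 0, halve the labels minus one; and it
  -- cannot contain both 0 and 2a.
  graph-cliqueFree : 1 ≤ a → CliqueFree graph (suc a)
  graph-cliqueFree 1≤a f pw with any? (λ i → toℕ (f i) ≟ 0)
  ... | no noZero =
    noApartFamily a (pred ∘ value) shiftedBelow
      λ i j i≢j → apart-pred (λ e → noZero (i , e)) (λ e → noZero (j , e)) (proj₁ (pw i j i≢j))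
    where
    value : Fin (suc a) → ℕ
    value i = toℕ (f i)
    shiftedBelow : ∀ i → pred (value i) < a + a
    shiftedBelow i with value i | toℕ<n (f i) | noZero ∘ (i ,_)
    ... | zero | _ | ≢0 = ⊥-elim (≢0 refl)
    ... | suc v | s≤s v<2a | _ = v<2a
  ... | yes (j , isZero) with any? (λ i → toℕ (f i) ≟ a + a)
  ...   | no noTop = noApartFamily a (toℕ ∘ f) below (λ i j i≢j → proj₁ (pw i j i≢j))
    where
    below : ∀ i → toℕ (f i) < a + a
    below i = ≤∧≢⇒< (s≤s⁻¹ (toℕ<n (f i))) (λ e → noTop (i , e))
  ...   | yes (i , isTop) = proj₁ (proj₂ (pw j i j≢i)) (isZero , isTop)
    where
    j≢i : j ≢ i
    j≢i refl = double≢0 1≤a (trans (≡-sym isTop) isZero)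

  stair-below : ∀ {d} z {n} → d ≤ 1 → n < a → d + stair z n < suc (a + a)
  stair-below z {n} d≤1 n<a = s≤s (≤-trans (+-mono-≤ d≤1 (stair≤ z n)) (doubled< n<a))

  -- A staircase with d = 0 never reaches 2a, one with d = 1 never contains 0.
  stair-noWrap : ∀ {d} z {n n′} → d ≤ 1 → n′ < a → ¬ WrapEdge (d + stair z n) (d + stair z n′)
  stair-noWrap z {n′ = n′} z≤n n′<a (_ , top) =
    <⇒≢ (≤-trans (s≤s (stair≤ z n′)) (doubled< n′<a)) top
  stair-noWrap z (s≤s z≤n) _ (() , _)

  stair-nonAdjacent : ∀ {d} z {n n′} → d ≤ 1 → n < a → n′ < a → n < n′ →
                      NonAdjacentInCycle (d + stair z n) (d + stair z n′)
  stair-nonAdjacent {d} z d≤1 n<a n′<a n<n′ =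
    inj₁ (apart-+ d (stair-gap z n<n′)) , stair-noWrap z d≤1 n′<a , stair-noWrap z d≤1 n<a

  graph-robust : Robust graph a
  graph-robust u w with avoidingStair (toℕ u) (toℕ w)
  ... | d , z , d≤1 , av = f , pairwise , avoids
    where
    value : Fin a → ℕ
    value i = d + stair z (toℕ i)
    f : Fin a → Fin (suc (a + a))
    f i = fromℕ< (stair-below z d≤1 (toℕ<n i))
    toℕ-f : ∀ i → toℕ (f i) ≡ value i
    toℕ-f i = toℕ-fromℕ< _
    nonAdjacent : ∀ i j → i ≢ j → NonAdjacentInCycle (value i) (value j)
    nonAdjacent i j i≢j with <-cmp (toℕ i) (toℕ j)
    ... | tri< lt _ _ = stair-nonAdjacent z d≤1 (toℕ<n i) (toℕ<n j) lt
    ... | tri≈ _ eq _ = ⊥-elim (i≢j (toℕ-injective eq))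
    ... | tri> _ _ gt = nonAdjacent-sym (stair-nonAdjacent z d≤1 (toℕ<n j) (toℕ<n i) gt)
    pairwise : Pairwise graph f
    pairwise i j i≢j =
      subst₂ NonAdjacentInCycle (≡-sym (toℕ-f i)) (≡-sym (toℕ-f j)) (nonAdjacent i j i≢j)
    avoids : ∀ i → Avoids (f i) u w
    avoids i = (λ e → proj₁ (av (toℕ i)) (trans (≡-sym (toℕ-f i)) (cong toℕ e)))
             , (λ e → proj₂ (av (toℕ i)) (trans (≡-sym (toℕ-f i)) (cong toℕ e)))

construction : ∀ a c → 1 ≤ a → βLe 2 (c + suc (a + a)) (suc (c + a)) (c * 3 + suc (a + a))
construction (suc b) c 1≤a =
  c * 3 + suc (a + a) , ≤-refl , tower c ,
  admissible (tower c) (c ↑ʳ zero) (tower-cliqueFree c (graph-cliqueFree 1≤a))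
                       (tower-robust (λ ()) c graph-robust)
  where
  a = suc b
  open OddCycleComplement a
  open Tower graph zero (suc zero)

vertexCount : ∀ a c → 4 * suc (c + a) ∸ (c + suc (a + a)) ∸ 2 ≡ c * 3 + suc (a + a)
vertexCount a c = begin
  4 * suc (c + a) ∸ K ∸ 2      ≡⟨ cong (λ x → x ∸ K ∸ 2) (split a c) ⟩
  (N + 2) + K ∸ K ∸ 2          ≡⟨ cong (_∸ 2) (m+n∸n≡m (N + 2) K) ⟩
  N + 2 ∸ 2                    ≡⟨ m+n∸n≡m N 2 ⟩
  N                            ∎
  where
  open ≡-Reasoning
  K = c + suc (a + a)
  N = c * 3 + suc (a + a)
  split : ∀ a c → 4 * suc (c + a) ≡ ((c * 3 + suc (a + a)) + 2) + (c + suc (a + a))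
  split = solve-∀

parameters : ∀ {k r} → r < k → k < 2 * r ∸ 1 →
             ∃₂ λ a c → 1 ≤ a × k ≡ c + suc (a + a) × r ≡ suc (c + a)
parameters {r = r} r<k k<2r-1 with m≤n⇒∃[o]m+o≡n r<k
... | b , refl with m≤n⇒∃[o]m+o≡n a<r
  where
  a<r : suc (suc b) ≤ r
  a<r = +-cancelˡ-≤ r _ _ (begin
    r + suc (suc b)    ≡⟨ trans (+-suc r (suc b)) (cong suc (+-suc r b)) ⟩
    suc (suc (r + b))  ≤⟨ k<2r-1 ⟩
    2 * r ∸ 1          ≤⟨ m∸n≤m (2 * r) 1 ⟩
    2 * r              ≡⟨ cong (r +_) (+-identityʳ r) ⟩
    r + r              ∎)
    where open ≤-Reasoning
... | c , refl = suc b , c , s≤s z≤n , k≡ b c , r≡ b c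
  where
  k≡ : ∀ b c → suc (suc (suc b) + c) + b ≡ c + suc (suc b + suc b)
  k≡ = solve-∀
  r≡ : ∀ b c → suc (suc b) + c ≡ suc (c + suc b)
  r≡ = solve-∀

proposition3p6 : (k r : ℕ) → 2 ≤ r → r < k → k < 2 * r ∸ 1 → βLe 2 k r (4 * r ∸ k ∸ 2)
proposition3p6 k r _ r<k k<2r-1 with parameters r<k k<2r-1
... | a , c , 1≤a , refl , refl =
  subst (βLe 2 _ _) (≡-sym (vertexCount a c)) (construction a c 1≤a)
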